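{- Let $k\ge1$, $r\ge0$, $n=2^r$, and let $I=(i_1,\dots,i_k)$ be nonnegative integers with $1\cdot i_1+2i_2+\dots+k\,i_k=r$. Let $\bar b_1,\dots,\bar b_n\in Z_{2^k}^{1+i_1+\dots+i_k}$ be all the elements of $\{1\}\times(2^{k-1}Z_{2^k})^{i_1}\times(2^{k-2}Z_{2^k})^{i_2}\times\dots\times(2^0Z_{2^k})^{i_k}$, ordered lexicographically, and let $B_I$ be the matrix with columns $\bar b_1,\dots,\bar b_n$. Then the linear code $\mathcal H_I=\{\bar h\in Z_{2^k}^n: B_I\bar h^T=\bar 0\}$ is a $1'$-perfect code in $(Z_{2^k}^n,d^\diamond)$.
   Context: Define $wt^\diamond:Z_{2^k}\to\mathbb R_{\ge0}$ by $wt^\diamond(0)=0$, $wt^\diamond(x)=1$ for odd $x$, $wt^\diamond(x)=2$ for even $x\ne0$, and $d^\diamond(\bar x,\bar y)=\sum_i wt^\diamond(y_i-x_i)$ on $Z_{2^k}^n$. Consider the graph on $Z_{2^k}^n$ in which two words are adjacent iff their $d^\diamond$-distance is $1$; it is regular and bipartite, with parts the words having an even (resp. odd) number of odd coordinates, and $d^\diamond$ is its graph distance. A set $C\subseteq Z_{2^k}^n$ is a $1'$-perfect code in $(Z_{2^k}^n,d^\diamond)$ if $C$ is contained in one of the two parts and every word of the other part is at $d^\diamond$-distance $1$ from exactly one element of $C$. -}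

module Defs where

open import Data.Nat using (ℕ; zero; suc; _+_; _*_; _∸_; _^_; _%_; NonZero; _≡ᵇ_)
open import Data.Nat.Properties using (m^n≢0)
open import Data.Nat.DivMod using (_mod_)
open import Data.Bool using (Bool; true; false; if_then_else_)
open import Data.Fin using (Fin; toℕ)
open import Data.List as L using (List; []; _∷_; concatMap; upTo)
open import Data.Vec as V using (Vec; []; _∷_; _++_; replicate; lookup; tabulate)
open import Data.Product using (Σ; _×_; _,_)
open import Relation.Binary.PropositionalEquality using (_≡_; _≢_)

Zk : ℕ → Set
Zk k = Fin (2 ^ k)

toZ : (k : ℕ) → ℕ → Zk k
toZ k m = _mod_ m (2 ^ k) {{m^n≢0 2 k}}

subZ : (k : ℕ) → Zk k → Zk k → Zk k
subZ k y x = toZ k (toℕ y + (2 ^ k ∸ toℕ x))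

wtℕ : ℕ → ℕ
wtℕ m = if m ≡ᵇ 0 then 0 else (if (m % 2) ≡ᵇ 1 then 1 else 2)

wt◇ : (k : ℕ) → Zk k → ℕ
wt◇ k x = wtℕ (toℕ x)

Word : ℕ → ℕ → Set
Word k n = Vec (Zk k) n

d◇ : (k : ℕ) {n : ℕ} → Word k n → Word k n → ℕ
d◇ k x y = V.sum (V.zipWith (λ a b → wt◇ k (subZ k b a)) x y)

oddCount : (k : ℕ) {n : ℕ} → Word k n → ℕ
oddCount k x = V.sum (V.map (λ a → toℕ a % 2) x)

part : (k : ℕ) {n : ℕ} → Word k n → ℕ
part k x = oddCount k x % 2

Is1'Perfect : (k n : ℕ) → (Word k n → Set) → Set
Is1'Perfect k n C =
  Σ ℕ λ p →
    (∀ c → C c → part k c ≡ p) ×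
    (∀ y → part k y ≢ p →
       Σ (Word k n) λ c → (C c × d◇ k c y ≡ 1) ×
         (∀ c′ → C c′ → d◇ k c′ y ≡ 1 → c′ ≡ c))

-- Values of a coordinate in group j (1 ≤ j ≤ k): 2^{k-j} Z_{2^k} =
-- { t · 2^{k-j} : 0 ≤ t < 2^j }, listed in increasing order.
groupVals : (k j : ℕ) → List (Zk k)
groupVals k j = L.map (λ t → toZ k (t * 2 ^ (k ∸ j))) (upTo (2 ^ j))

-- For I = (i_1, …, i_k) given as a vector, the coordinate value lists of
-- (2^{k-j} Z)^{i_j} for j = j₀+1, j₀+2, …
groupsFrom : (k j₀ : ℕ) {m : ℕ} → (I : Vec ℕ m) → Vec (List (Zk k)) (V.sum I)
groupsFrom k j₀ [] = []
groupsFrom k j₀ (i ∷ is) = replicate i (groupVals k (suc j₀)) ++ groupsFrom k (suc j₀) is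

coordVals : (k : ℕ) → (I : Vec ℕ k) → Vec (List (Zk k)) (suc (V.sum I))
coordVals k I = (toZ k 1 L.∷ L.[]) ∷ groupsFrom k 0 I

lexProd : {A : Set} {d : ℕ} → Vec (List A) d → List (Vec A d)
lexProd [] = [] L.∷ L.[]
lexProd (xs ∷ xss) = concatMap (λ x → L.map (x ∷_) (lexProd xss)) xs

columns : (k : ℕ) → (I : Vec ℕ k) → List (Vec (Zk k) (suc (V.sum I)))
columns k I = lexProd (coordVals k I)

len : (k : ℕ) → Vec ℕ k → ℕ
len k I = L.length (columns k I)

HI : (k : ℕ) → (I : Vec ℕ k) → Word k (len k I) → Set
HI k I h = ∀ (ρ : Fin (suc (V.sum I))) →
  toZ k (V.sum (tabulate λ j → toℕ (lookup (L.lookup (columns k I) j) ρ) * toℕ (lookup h j))) ≡ toZ k 0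

weightedSum : {m : ℕ} → Vec ℕ m → ℕ
weightedSum I = V.sum (tabulate λ j → suc (toℕ j) * lookup I j)

-- The first row of B_I is all ones, so the first syndrome entry of a word
-- has the parity of its number of odd coordinates; hence H_I lies in the even
-- part. If y is odd, its syndrome s has an odd, hence invertible, first entry
-- a, and u·s (with u = a⁻¹) starts with 1 and inherits from the rows the
-- divisibility 2^{k-j} ∣ s_ρ, so it is a column b̄_j. Subtracting a from y_j
-- gives a codeword at distance wt◇(a) = 1. Conversely, a codeword at distance
-- 1 differs from y in one coordinate j' by some δ with δ·b̄_{j'} = s; the
-- first row forces δ = a, so b̄_{j'} = u·s = b̄_j and j' = j.
module Submission where

open import Defs
open import Data.Nat using (ℕ; zero; suc; ≢-nonZero; ≢-nonZero⁻¹; _+_; _*_; _∸_; _^_; _%_; _≤_; _<_; _≥_; _≡ᵇ_; NonZero; s≤s)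
open import Data.Nat.Properties
open import Data.Nat.DivMod
open import Data.Nat.Divisibility using (_∣_; divides; _∣0; n∣m*n; ∣n⇒∣m*n; ∣m⇒∣m*n; ∣m∣n⇒∣m+n; m%n≡0⇒n∣m; n∣m⇒m%n≡0)
open import Data.Nat.Solver using (module +-*-Solver)
open import Data.Fin as F using (Fin; zero; suc; toℕ)
open import Data.Fin.Properties as Fin using (toℕ-fromℕ<; toℕ-injective; toℕ<n)
open import Data.List as L using (List; []; _∷_; cartesianProductWith; upTo)
open import Data.List.Properties using (length-++; length-map; map-applyUpTo; length-upTo)
open import Data.List.Membership.Propositional using (_∈_)
open import Data.List.Membership.Propositional.Properties
  using (∈-cartesianProductWith⁻; ∈-cartesianProductWith⁺; ∈-lookup; ∈-map⁻; ∈-map⁺; ∈-upTo⁺)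
open import Data.List.Relation.Unary.All as All using ()
open import Data.List.Relation.Unary.Any as Any using (here)
open import Data.List.Relation.Unary.Any.Properties using (lookup-index)
open import Data.List.Relation.Unary.AllPairs as AllPairs using (_∷_)
open import Data.List.Relation.Unary.Unique.Propositional using (Unique)
open import Data.List.Relation.Unary.Unique.Propositional.Properties using (cartesianProductWith⁺; applyUpTo⁺₁)
open import Data.Vec as V using (Vec; []; _∷_; lookup; tabulate; replicate; _++_; _[_]≔_)
open import Data.Vec.Properties
  using (∷-injective; lookup∘update; lookup∘update′; lookup-zipWith; lookup∘tabulate; tabulate∘lookup; tabulate-cong; tabulate-∘; map-∘)
open import Data.Vec.Relation.Binary.Pointwise.Extensional using (ext; Pointwise-≡⇒≡)
open import Data.Product using (∃-syntax; _×_; _,_; proj₁; proj₂)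
open import Data.Bool using (true; false)
open import Data.Empty using (⊥-elim)
open import Function using (_∘_; _⇔_; mk⇔; Equivalence)
open import Relation.Nullary using (yes; no)
open import Relation.Binary.PropositionalEquality
open ≡-Reasoning

module Congruence (N : ℕ) .{{_ : NonZero N}} where

  infix 4 _≋_
  _≋_ : ℕ → ℕ → Set
  x ≋ y = x % N ≡ y % N

  +-cong : ∀ {x y u v} → x ≋ y → u ≋ v → x + u ≋ y + v
  +-cong {x} {y} {u} {v} x≋y u≋v = begin
    (x + u) % N             ≡⟨ %-distribˡ-+ x u N ⟩
    (x % N + u % N) % N     ≡⟨ cong₂ (λ a b → (a + b) % N) x≋y u≋v ⟩
    (y % N + v % N) % N     ≡⟨ %-distribˡ-+ y v N ⟨
    (y + v) % N             ∎

  *-cong : ∀ {x y u v} → x ≋ y → u ≋ v → x * u ≋ y * v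
  *-cong {x} {y} {u} {v} x≋y u≋v = begin
    (x * u) % N             ≡⟨ %-distribˡ-* x u N ⟩
    (x % N * (u % N)) % N   ≡⟨ cong₂ (λ a b → (a * b) % N) x≋y u≋v ⟩
    (y % N * (v % N)) % N   ≡⟨ %-distribˡ-* y v N ⟨
    (y * v) % N             ∎

  *-congˡ : ∀ x {u v} → u ≋ v → x * u ≋ x * v
  *-congˡ x = *-cong {x} refl

  *-congʳ : ∀ u {x y} → x ≋ y → x * u ≋ y * u
  *-congʳ u x≋y = *-cong x≋y (refl {x = u % N})

  m%N≋m : ∀ m → m % N ≋ m
  m%N≋m m = m%n%n≡m%n m N

  ≋∧<⇒≡ : ∀ {x y} → x ≋ y → x < N → y < N → x ≡ y
  ≋∧<⇒≡ {x} {y} x≋y x<N y<N = trans (sym (m<n⇒m%n≡m x<N)) (trans x≋y (m<n⇒m%n≡m y<N))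

  +-cancelʳ : ∀ {x y} c → x + c ≋ y + c → x ≋ y
  +-cancelʳ {x} {y} c x+c≋y+c = begin
    x % N                   ≡⟨ absorb x ⟨
    (x + c + t) % N         ≡⟨ +-cong {x + c} x+c≋y+c (refl {x = t % N}) ⟩
    (y + c + t) % N         ≡⟨ absorb y ⟩
    y % N                   ∎
    where
    t : ℕ
    t = c * N ∸ c
    absorb : ∀ z → (z + c + t) % N ≡ z % N
    absorb z = begin
      (z + c + t) % N       ≡⟨ cong (_% N) (+-assoc z c t) ⟩
      (z + (c + t)) % N     ≡⟨ cong (λ m → (z + m) % N) (m+[n∸m]≡n (m≤m*n c N)) ⟩
      (z + c * N) % N       ≡⟨ [m+kn]%n≡m%n z c N ⟩
      z % N                 ∎

  *-cancelʳ : ∀ {a u x y} → a * u ≋ 1 → x * a ≋ y * a → x ≋ y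
  *-cancelʳ {a} {u} {x} {y} au≋1 xa≋ya = begin
    x % N                   ≡⟨ cong (_% N) (*-identityʳ x) ⟨
    (x * 1) % N             ≡⟨ *-congˡ x (sym au≋1) ⟩
    (x * (a * u)) % N       ≡⟨ cong (_% N) (*-assoc x a u) ⟨
    (x * a * u) % N         ≡⟨ *-congʳ u xa≋ya ⟩
    (y * a * u) % N         ≡⟨ cong (_% N) (*-assoc y a u) ⟩
    (y * (a * u)) % N       ≡⟨ *-congˡ y au≋1 ⟩
    (y * 1) % N             ≡⟨ cong (_% N) (*-identityʳ y) ⟩
    y % N                   ∎

  divisor≢0 : ∀ {d} → d ∣ N → NonZero d
  divisor≢0 (divides q N≡q*d) = ≢-nonZero λ d≡0 → ≢-nonZero⁻¹ N (trans N≡q*d (trans (cong (q *_) d≡0) (*-zeroʳ q)))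

  ∣⇒∣% : ∀ {d x} → d ∣ N → d ∣ x → d ∣ x % N
  ∣⇒∣% {d} {x} d∣N d∣x = m%n≡0⇒n∣m (x % N) d (trans (m∣n⇒o%n%m≡o%m d N x d∣N) (n∣m⇒m%n≡0 x d d∣x))
    where instance _ = divisor≢0 d∣N

  ≋⇒%-divisor : ∀ {d x y} .{{_ : NonZero d}} → d ∣ N → x ≋ y → x % d ≡ y % d
  ≋⇒%-divisor {d} {x} {y} d∣N x≋y = begin
    x % d                   ≡⟨ m∣n⇒o%n%m≡o%m d N x d∣N ⟨
    x % N % d               ≡⟨ cong (_% d) x≋y ⟩
    y % N % d               ≡⟨ m∣n⇒o%n%m≡o%m d N y d∣N ⟩
    y % d                   ∎

odd^2^m : ∀ {a t} → a ≡ 1 + t * 2 → ∀ m → ∃[ s ] a ^ (2 ^ m) ≡ 1 + s * 2 ^ suc m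
odd^2^m {a} {t} a≡1+2t zero = t , trans (*-identityʳ a) a≡1+2t
odd^2^m {a} {t} a≡1+2t (suc m) with odd^2^m {t = t} a≡1+2t m
... | s , eq = s + s * s * 2 ^ m , (begin
  a ^ (2 ^ suc m)               ≡⟨ cong (a ^_) (*-comm 2 (2 ^ m)) ⟩
  a ^ (2 ^ m * 2)               ≡⟨ ^-*-assoc a (2 ^ m) 2 ⟨
  (a ^ (2 ^ m)) ^ 2             ≡⟨ cong (_^ 2) eq ⟩
  (1 + s * (2 * 2 ^ m)) ^ 2     ≡⟨ square s (2 ^ m) ⟩
  1 + (s + s * s * 2 ^ m) * (2 * (2 * 2 ^ m)) ∎)
  where
  open +-*-Solver
  square : ∀ s p → (1 + s * (2 * p)) ^ 2 ≡ 1 + (s + s * s * p) * (2 * (2 * p))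
  square = solve 2 (λ s p → (con 1 :+ s :* (con 2 :* p)) :^ 2 := con 1 :+ (s :+ s :* s :* p) :* (con 2 :* (con 2 :* p))) refl

odd-invertible : ∀ k {a} → a % 2 ≡ 1 → ∃[ u ] ∃[ q ] a * u ≡ 1 + q * 2 ^ k
odd-invertible k {a} a-odd with odd^2^m {t = a / 2} (trans (m≡m%n+[m/n]*n a 2) (cong (_+ (a / 2) * 2) a-odd)) k
... | s , eq = a ^ (2 ^ k ∸ 1) , s * 2 , (begin
  a * a ^ (2 ^ k ∸ 1)           ≡⟨ cong (a ^_) (m+[n∸m]≡n (m^n>0 2 k)) ⟩
  a ^ (2 ^ k)                   ≡⟨ eq ⟩
  1 + s * (2 * 2 ^ k)           ≡⟨ cong (1 +_) (*-assoc s 2 (2 ^ k)) ⟨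
  1 + s * 2 * 2 ^ k             ∎)

2∣2^ : ∀ {k} → k ≥ 1 → 2 ∣ 2 ^ k
2∣2^ {suc k} _ = divides (2 ^ k) (*-comm 2 (2 ^ k))

%2≢0⇒%2≡1 : ∀ m → m % 2 ≢ 0 → m % 2 ≡ 1
%2≢0⇒%2≡1 m m%2≢0 with m % 2 | m%n<n m 2
... | zero        | _ = ⊥-elim (m%2≢0 refl)
... | suc zero    | _ = refl
... | suc (suc _) | s≤s (s≤s ())

Unique-lookup-injective : ∀ {A : Set} {xs : List A} → Unique xs → ∀ i j → L.lookup xs i ≡ L.lookup xs j → i ≡ j
Unique-lookup-injective (_ ∷ _) zero zero _ = refl
Unique-lookup-injective (x∉ ∷ _) zero (suc j) eq = ⊥-elim (All.lookup x∉ (∈-lookup j) eq)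
Unique-lookup-injective (x∉ ∷ _) (suc i) zero eq = ⊥-elim (All.lookup x∉ (∈-lookup i) (sym eq))
Unique-lookup-injective (_ ∷ u) (suc i) (suc j) eq = cong F.suc (Unique-lookup-injective u i j eq)

module _ {A : Set} where

  lexProd-∷ : ∀ {d} (xs : List A) (xss : Vec (List A) d) →
    lexProd (xs ∷ xss) ≡ cartesianProductWith V._∷_ xs (lexProd xss)
  lexProd-∷ [] xss = refl
  lexProd-∷ (x ∷ xs) xss = cong (L.map (x ∷_) (lexProd xss) L.++_) (lexProd-∷ xs xss)

  ∈-lexProd⁻ : ∀ {d} (xss : Vec (List A) d) {v} → v ∈ lexProd xss → ∀ ρ → lookup v ρ ∈ lookup xss ρ
  ∈-lexProd⁻ (xs ∷ xss) {v} v∈ ρ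
    with ∈-cartesianProductWith⁻ V._∷_ xs (lexProd xss) (subst (v ∈_) (lexProd-∷ xs xss) v∈)
  ∈-lexProd⁻ (xs ∷ xss) v∈ zero    | _ , _ , x∈ , _ , refl = x∈
  ∈-lexProd⁻ (xs ∷ xss) v∈ (suc ρ) | _ , _ , _ , w∈ , refl = ∈-lexProd⁻ xss w∈ ρ

  ∈-lexProd⁺ : ∀ {d} (xss : Vec (List A) d) (v : Vec A d) → (∀ ρ → lookup v ρ ∈ lookup xss ρ) → v ∈ lexProd xss
  ∈-lexProd⁺ [] [] _ = here refl
  ∈-lexProd⁺ (xs ∷ xss) (x ∷ v) v∈ = subst (x ∷ v ∈_) (sym (lexProd-∷ xs xss))
    (∈-cartesianProductWith⁺ V._∷_ (v∈ zero) (∈-lexProd⁺ xss v (v∈ ∘ suc)))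

  lexProd-unique : ∀ {d} (xss : Vec (List A) d) → (∀ ρ → Unique (lookup xss ρ)) → Unique (lexProd xss)
  lexProd-unique [] _ = All.[] ∷ AllPairs.[]
  lexProd-unique (xs ∷ xss) u = subst Unique (sym (lexProd-∷ xs xss))
    (cartesianProductWith⁺ V._∷_ ∷-injective (u zero) (lexProd-unique xss (u ∘ suc)))

  length-lexProd-∷ : ∀ {d} (xs : List A) (xss : Vec (List A) d) →
    L.length (lexProd (xs ∷ xss)) ≡ L.length xs * L.length (lexProd xss)
  length-lexProd-∷ [] xss = refl
  length-lexProd-∷ (x ∷ xs) xss = begin
    L.length (L.map (x ∷_) (lexProd xss) L.++ lexProd (xs ∷ xss))   ≡⟨ length-++ (L.map (x ∷_) (lexProd xss)) ⟩
    L.length (L.map (x ∷_) (lexProd xss)) + L.length (lexProd (xs ∷ xss))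
      ≡⟨ cong₂ _+_ (length-map (x ∷_) (lexProd xss)) (length-lexProd-∷ xs xss) ⟩
    L.length (lexProd xss) + L.length xs * L.length (lexProd xss)   ∎

  length-lexProd-replicate : ∀ {d} i (xs : List A) (xss : Vec (List A) d) →
    L.length (lexProd (replicate i xs ++ xss)) ≡ L.length xs ^ i * L.length (lexProd xss)
  length-lexProd-replicate zero xs xss = sym (+-identityʳ _)
  length-lexProd-replicate (suc i) xs xss = begin
    L.length (lexProd (xs ∷ replicate i xs ++ xss))                ≡⟨ length-lexProd-∷ xs (replicate i xs ++ xss) ⟩
    L.length xs * L.length (lexProd (replicate i xs ++ xss))       ≡⟨ cong (L.length xs *_) (length-lexProd-replicate i xs xss) ⟩
    L.length xs * (L.length xs ^ i * L.length (lexProd xss))       ≡⟨ *-assoc (L.length xs) _ _ ⟨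
    L.length xs ^ suc i * L.length (lexProd xss)                   ∎

module _ {A : Set} {n : ℕ} where

  AgreeOutside : Fin n → Vec A n → Vec A n → Set
  AgreeOutside j c y = ∀ i → i ≢ j → lookup c i ≡ lookup y i

  AgreeOutside-update : ∀ j (y : Vec A n) x → AgreeOutside j (y [ j ]≔ x) y
  AgreeOutside-update j y x i i≢j = lookup∘update′ i≢j y x

  AgreeOutside⇒update : ∀ {j} c y → AgreeOutside j c y → c ≡ y [ j ]≔ lookup c j
  AgreeOutside⇒update {j} c y agree = Pointwise-≡⇒≡ (ext pointwise)
    where
    pointwise : ∀ i → lookup c i ≡ lookup (y [ j ]≔ lookup c j) i
    pointwise i with i F.≟ j
    ... | yes refl = sym (lookup∘update i y (lookup c i))
    ... | no i≢j = trans (agree i i≢j) (sym (lookup∘update′ i≢j y (lookup c j)))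

sum-zeros : ∀ {n} (v : Vec ℕ n) → (∀ i → lookup v i ≡ 0) → V.sum v ≡ 0
sum-zeros [] _ = refl
sum-zeros (x ∷ v) zeros = cong₂ _+_ (zeros zero) (sum-zeros v (zeros ∘ suc))

sum≡0⇒zeros : ∀ {n} (v : Vec ℕ n) → V.sum v ≡ 0 → ∀ i → lookup v i ≡ 0
sum≡0⇒zeros (x ∷ v) Σ≡0 zero = m+n≡0⇒m≡0 x Σ≡0
sum≡0⇒zeros (x ∷ v) Σ≡0 (suc i) = sum≡0⇒zeros v (m+n≡0⇒n≡0 x Σ≡0) i

sum-single : ∀ {n} (v : Vec ℕ n) j → (∀ i → i ≢ j → lookup v i ≡ 0) → V.sum v ≡ lookup v j
sum-single (x ∷ v) zero zeros = trans (cong (x +_) (sum-zeros v (λ i → zeros (suc i) (λ ())))) (+-identityʳ x)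
sum-single (x ∷ v) (suc j) zeros =
  cong₂ _+_ (zeros zero (λ ())) (sum-single v j (λ i i≢j → zeros (suc i) (i≢j ∘ Fin.suc-injective)))

sum≡1⇒single : ∀ {n} (v : Vec ℕ n) → V.sum v ≡ 1 → ∃[ j ] ∀ i → i ≢ j → lookup v i ≡ 0
sum≡1⇒single (zero ∷ v) Σ≡1 with sum≡1⇒single v Σ≡1
... | j , zeros = suc j , λ { zero _ → refl ; (suc i) i≢j → zeros i (i≢j ∘ cong F.suc) }
sum≡1⇒single (suc zero ∷ v) Σ≡1 = zero , λ { zero 0≢0 → ⊥-elim (0≢0 refl) ; (suc i) _ → sum≡0⇒zeros v (suc-injective Σ≡1) i }
sum≡1⇒single (suc (suc _) ∷ _) ()

sum-tabulate-update : ∀ {n} (f g : Fin n → ℕ) j → (∀ i → i ≢ j → f i ≡ g i) →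
  V.sum (tabulate f) + g j ≡ V.sum (tabulate g) + f j
sum-tabulate-update {suc n} f g zero f≡g = begin
  f zero + S f + g zero     ≡⟨ cong (λ m → f zero + m + g zero) (cong V.sum (tabulate-cong (λ i → f≡g (suc i) (λ ())))) ⟩
  f zero + S g + g zero     ≡⟨ +-assoc (f zero) _ _ ⟩
  f zero + (S g + g zero)   ≡⟨ +-comm (f zero) _ ⟩
  S g + g zero + f zero     ≡⟨ cong (_+ f zero) (+-comm (S g) (g zero)) ⟩
  g zero + S g + f zero     ∎
  where
  S : (Fin (suc n) → ℕ) → ℕ
  S h = V.sum (tabulate (h ∘ suc))
sum-tabulate-update {suc n} f g (suc j) f≡g = begin
  f zero + S f + g (suc j)      ≡⟨ +-assoc (f zero) _ _ ⟩
  f zero + (S f + g (suc j))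
    ≡⟨ cong₂ _+_ (f≡g zero (λ ())) (sum-tabulate-update (f ∘ suc) (g ∘ suc) j (λ i i≢j → f≡g (suc i) (i≢j ∘ Fin.suc-injective))) ⟩
  g zero + (S g + f (suc j))    ≡⟨ +-assoc (g zero) _ _ ⟨
  g zero + S g + f (suc j)      ∎
  where
  S : (Fin (suc n) → ℕ) → ℕ
  S h = V.sum (tabulate (h ∘ suc))

∣-sum : ∀ {n} d (f : Fin n → ℕ) → (∀ i → d ∣ f i) → d ∣ V.sum (tabulate f)
∣-sum {zero} d f _ = d ∣0
∣-sum {suc n} d f d∣f = ∣m∣n⇒∣m+n (d∣f zero) (∣-sum d (f ∘ suc) (d∣f ∘ suc))

sum-map-%2 : ∀ {n} (v : Vec ℕ n) → V.sum (V.map (_% 2) v) % 2 ≡ V.sum v % 2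
sum-map-%2 [] = refl
sum-map-%2 (x ∷ v) = begin
  (x % 2 + V.sum (V.map (_% 2) v)) % 2          ≡⟨ %-distribˡ-+ (x % 2) _ 2 ⟩
  (x % 2 % 2 + V.sum (V.map (_% 2) v) % 2) % 2  ≡⟨ cong₂ (λ a b → (a + b) % 2) (m%n%n≡m%n x 2) (sum-map-%2 v) ⟩
  (x % 2 + V.sum v % 2) % 2                     ≡⟨ %-distribˡ-+ x (V.sum v) 2 ⟨
  (x + V.sum v) % 2                             ∎

wtℕ≡0⇒≡0 : ∀ m → wtℕ m ≡ 0 → m ≡ 0
wtℕ≡0⇒≡0 zero _ = refl
wtℕ≡0⇒≡0 (suc m) wt≡0 with suc m % 2 ≡ᵇ 1
wtℕ≡0⇒≡0 (suc m) () | true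
wtℕ≡0⇒≡0 (suc m) () | false

odd⇒wtℕ≡1 : ∀ m → m % 2 ≡ 1 → wtℕ m ≡ 1
odd⇒wtℕ≡1 (suc m) m-odd rewrite m-odd = refl

module Residues (k : ℕ) where

  N : ℕ
  N = 2 ^ k

  instance
    N≢0 : NonZero N
    N≢0 = m^n≢0 2 k

  open Congruence N public

  toℕ-toZ : ∀ m → toℕ (toZ k m) ≡ m % N
  toℕ-toZ m = toℕ-fromℕ< _

  toℕ-toZ≋ : ∀ m → toℕ (toZ k m) ≋ m
  toℕ-toZ≋ m = trans (cong (_% N) (toℕ-toZ m)) (m%N≋m m)

  toZ-≋ : ∀ {m m′} → toZ k m ≡ toZ k m′ ⇔ m ≋ m′
  toZ-≋ {m} {m′} = mk⇔
    (λ eq → trans (sym (toℕ-toZ m)) (trans (cong toℕ eq) (toℕ-toZ m′)))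
    (λ m≋m′ → toℕ-injective (trans (toℕ-toZ m) (trans m≋m′ (sym (toℕ-toZ m′)))))

  ≋⇒≡ : {x y : Zk k} → toℕ x ≋ toℕ y → x ≡ y
  ≋⇒≡ {x} {y} x≋y = toℕ-injective (≋∧<⇒≡ x≋y (toℕ<n x) (toℕ<n y))

  subZ-+ : (y x : Zk k) → toℕ (subZ k y x) + toℕ x ≋ toℕ y
  subZ-+ y x = begin
    (toℕ (subZ k y x) + toℕ x) % N          ≡⟨ +-cong (toℕ-toZ≋ (toℕ y + (N ∸ toℕ x))) (refl {x = toℕ x % N}) ⟩
    (toℕ y + (N ∸ toℕ x) + toℕ x) % N       ≡⟨ cong (_% N) (+-assoc (toℕ y) _ _) ⟩
    (toℕ y + (N ∸ toℕ x + toℕ x)) % N       ≡⟨ cong (λ m → (toℕ y + m) % N) (m∸n+n≡m (<⇒≤ (toℕ<n x))) ⟩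
    (toℕ y + N) % N                         ≡⟨ [m+n]%n≡m%n (toℕ y) N ⟩
    toℕ y % N                               ∎

  subZ-involutive : (y x : Zk k) → subZ k y (subZ k y x) ≡ x
  subZ-involutive y x = ≋⇒≡ (+-cancelʳ (toℕ (subZ k y x))
    (trans (subZ-+ y (subZ k y x)) (sym (trans (cong (_% N) (+-comm (toℕ x) _)) (subZ-+ y x)))))

  subZ-self : (y : Zk k) → toℕ (subZ k y y) ≡ 0
  subZ-self y = ≋∧<⇒≡ (+-cancelʳ (toℕ y) (subZ-+ y y)) (toℕ<n _) (m^n>0 2 k)

  subZ≡0⇒≡ : (y x : Zk k) → toℕ (subZ k y x) ≡ 0 → x ≡ y
  subZ≡0⇒≡ y x y-x≡0 = ≋⇒≡ (trans (cong (λ m → (m + toℕ x) % N) (sym y-x≡0)) (subZ-+ y x))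

  d◇≡1⇒AgreeOutside : ∀ {n} (c y : Word k n) → d◇ k c y ≡ 1 → ∃[ j ] AgreeOutside j c y
  d◇≡1⇒AgreeOutside c y d≡1 with sum≡1⇒single (V.zipWith (λ a b → wt◇ k (subZ k b a)) c y) d≡1
  ... | j , zeros = j , λ i i≢j → subZ≡0⇒≡ (lookup y i) (lookup c i)
    (wtℕ≡0⇒≡0 _ (trans (sym (lookup-zipWith (λ a b → wt◇ k (subZ k b a)) i c y)) (zeros i i≢j)))

  AgreeOutside⇒d◇ : ∀ {n j} (c y : Word k n) → AgreeOutside j c y → d◇ k c y ≡ wt◇ k (subZ k (lookup y j) (lookup c j))
  AgreeOutside⇒d◇ {j = j} c y agree = trans (sum-single (V.zipWith F c y) j zeros) (lookup-zipWith F j c y)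
    where
    F : Zk k → Zk k → ℕ
    F a b = wt◇ k (subZ k b a)
    zeros : ∀ i → i ≢ j → lookup (V.zipWith F c y) i ≡ 0
    zeros i i≢j = begin
      lookup (V.zipWith F c y) i           ≡⟨ lookup-zipWith F i c y ⟩
      wt◇ k (subZ k (lookup y i) (lookup c i)) ≡⟨ cong (λ a → wt◇ k (subZ k (lookup y i) a)) (agree i i≢j) ⟩
      wt◇ k (subZ k (lookup y i) (lookup y i)) ≡⟨ cong wtℕ (subZ-self (lookup y i)) ⟩
      0                                    ∎

  part≡sum%2 : ∀ {n} (h : Word k n) → part k h ≡ V.sum (V.map toℕ h) % 2
  part≡sum%2 h = trans (cong (λ v → V.sum v % 2) (map-∘ (_% 2) toℕ h)) (sum-map-%2 (V.map toℕ h))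

  step : ℕ → ℕ
  step j = 2 ^ (k ∸ j)

  step≢0 : ∀ j → NonZero (step j)
  step≢0 j = m^n≢0 2 (k ∸ j)

  N≡2^j*step : ∀ {j} → j ≤ k → N ≡ 2 ^ j * step j
  N≡2^j*step {j} j≤k = trans (cong (2 ^_) (sym (m+[n∸m]≡n j≤k))) (^-distribˡ-+-* 2 j (k ∸ j))

  step∣N : ∀ {j} → j ≤ k → step j ∣ N
  step∣N {j} j≤k = divides (2 ^ j) (N≡2^j*step j≤k)

  ∈-groupVals⁻ : ∀ {j} → j ≤ k → ∀ {x} → x ∈ groupVals k j → step j ∣ toℕ x
  ∈-groupVals⁻ {j} j≤k x∈ with ∈-map⁻ (λ t → toZ k (t * step j)) x∈
  ... | t , _ , refl = subst (step j ∣_) (sym (toℕ-toZ (t * step j))) (∣⇒∣% (step∣N j≤k) (n∣m*n t))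

  ∈-groupVals⁺ : ∀ {j} → j ≤ k → (x : Zk k) → step j ∣ toℕ x → x ∈ groupVals k j
  ∈-groupVals⁺ {j} j≤k x (divides q x≡q*step) =
    subst (_∈ groupVals k j) (sym x≡toZ) (∈-map⁺ (λ t → toZ k (t * step j)) (∈-upTo⁺ q<2^j))
    where
    q<2^j : q < 2 ^ j
    q<2^j = *-cancelʳ-< (step j) q (2 ^ j) (subst₂ _<_ x≡q*step (N≡2^j*step j≤k) (toℕ<n x))
    x≡toZ : x ≡ toZ k (q * step j)
    x≡toZ = toℕ-injective (trans x≡q*step (sym (trans (toℕ-toZ (q * step j)) (m<n⇒m%n≡m (subst (_< N) x≡q*step (toℕ<n x))))))

  groupVals-unique : ∀ {j} → j ≤ k → Unique (groupVals k j)
  groupVals-unique {j} j≤k = subst Unique (sym (map-applyUpTo (λ t → t) (λ t → toZ k (t * step j)) (2 ^ j)))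
    (applyUpTo⁺₁ _ (2 ^ j) distinct)
    where
    <N : ∀ {t} → t < 2 ^ j → t * step j < N
    <N {t} t<2^j = subst (t * step j <_) (sym (N≡2^j*step j≤k)) (*-monoˡ-< (step j) {{step≢0 j}} t<2^j)
    distinct : ∀ {s t} → s < t → t < 2 ^ j → toZ k (s * step j) ≢ toZ k (t * step j)
    distinct {s} {t} s<t t<2^j eq = <⇒≢ s<t (*-cancelʳ-≡ s t (step j) {{step≢0 j}}
      (≋∧<⇒≡ (Equivalence.to toZ-≋ eq) (<N (<-trans s<t t<2^j)) (<N t<2^j)))

  groupsFrom-lookup : ∀ j₀ {m} (J : Vec ℕ m) → j₀ + m ≤ k →
    ∀ ρ → ∃[ j ] j ≤ k × lookup (groupsFrom k j₀ J) ρ ≡ groupVals k j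
  groupsFrom-lookup j₀ [] _ ()
  groupsFrom-lookup j₀ {suc m} (i ∷ J) j₀+m≤k = replicated i
    where
    rest≤k : suc j₀ + m ≤ k
    rest≤k = subst (_≤ k) (+-suc j₀ m) j₀+m≤k
    replicated : ∀ i ρ → ∃[ j ] j ≤ k × lookup (replicate i (groupVals k (suc j₀)) ++ groupsFrom k (suc j₀) J) ρ ≡ groupVals k j
    replicated zero ρ = groupsFrom-lookup (suc j₀) J rest≤k ρ
    replicated (suc i) zero = suc j₀ , ≤-trans (m≤m+n (suc j₀) m) rest≤k , refl
    replicated (suc i) (suc ρ) = replicated i ρ

weightedSumFrom : ℕ → ∀ {m} → Vec ℕ m → ℕ
weightedSumFrom j₀ [] = 0
weightedSumFrom j₀ (i ∷ J) = suc j₀ * i + weightedSumFrom (suc j₀) J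

weightedSum≡weightedSumFrom : ∀ j₀ {m} (J : Vec ℕ m) →
  V.sum (tabulate λ t → suc (j₀ + toℕ t) * lookup J t) ≡ weightedSumFrom j₀ J
weightedSum≡weightedSumFrom j₀ [] = refl
weightedSum≡weightedSumFrom j₀ (i ∷ J) = cong₂ _+_ (cong (λ m → suc m * i) (+-identityʳ j₀))
  (trans (cong V.sum (tabulate-cong (λ t → cong (λ m → suc m * lookup J t) (+-suc j₀ (toℕ t)))))
         (weightedSum≡weightedSumFrom (suc j₀) J))

length-groupVals : ∀ k j → L.length (groupVals k j) ≡ 2 ^ j
length-groupVals k j = trans (length-map _ (upTo (2 ^ j))) (length-upTo (2 ^ j))

length-lexProd-groupsFrom : ∀ k j₀ {m} (J : Vec ℕ m) →
  L.length (lexProd (groupsFrom k j₀ J)) ≡ 2 ^ weightedSumFrom j₀ J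
length-lexProd-groupsFrom k j₀ [] = refl
length-lexProd-groupsFrom k j₀ (i ∷ J) = begin
  L.length (lexProd (replicate i (groupVals k (suc j₀)) ++ groupsFrom k (suc j₀) J))
    ≡⟨ length-lexProd-replicate i _ _ ⟩
  L.length (groupVals k (suc j₀)) ^ i * L.length (lexProd (groupsFrom k (suc j₀) J))
    ≡⟨ cong₂ (λ a b → a ^ i * b) (length-groupVals k (suc j₀)) (length-lexProd-groupsFrom k (suc j₀) J) ⟩
  (2 ^ suc j₀) ^ i * 2 ^ weightedSumFrom (suc j₀) J
    ≡⟨ cong (_* 2 ^ weightedSumFrom (suc j₀) J) (^-*-assoc 2 (suc j₀) i) ⟩
  2 ^ (suc j₀ * i) * 2 ^ weightedSumFrom (suc j₀) J
    ≡⟨ ^-distribˡ-+-* 2 (suc j₀ * i) _ ⟨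
  2 ^ (suc j₀ * i + weightedSumFrom (suc j₀) J) ∎

len≡2^weightedSum : ∀ k (I : Vec ℕ k) → len k I ≡ 2 ^ weightedSum I
len≡2^weightedSum k I = begin
  len k I                                 ≡⟨ length-lexProd-∷ (toZ k 1 ∷ []) (groupsFrom k 0 I) ⟩
  1 * L.length (lexProd (groupsFrom k 0 I)) ≡⟨ *-identityˡ _ ⟩
  L.length (lexProd (groupsFrom k 0 I))   ≡⟨ length-lexProd-groupsFrom k 0 I ⟩
  2 ^ weightedSumFrom 0 I                 ≡⟨ cong (2 ^_) (weightedSum≡weightedSumFrom 0 I) ⟨
  2 ^ weightedSum I                       ∎

module ParityCheck (k : ℕ) (k≥1 : k ≥ 1) (I : Vec ℕ k) where

  open Residues k

  D : ℕ
  D = suc (V.sum I)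

  n : ℕ
  n = len k I

  col : Fin n → Vec (Zk k) D
  col j = L.lookup (columns k I) j

  entry : Fin n → Fin D → ℕ
  entry j ρ = toℕ (lookup (col j) ρ)

  syndrome : Word k n → Fin D → ℕ
  syndrome h ρ = V.sum (tabulate λ j → entry j ρ * toℕ (lookup h j))

  HI⇔syndrome≋0 : ∀ h → HI k I h ⇔ (∀ ρ → syndrome h ρ ≋ 0)
  HI⇔syndrome≋0 h = mk⇔ (λ hI ρ → Equivalence.to toZ-≋ (hI ρ)) (λ s≋0 ρ → Equivalence.from toZ-≋ (s≋0 ρ))

  2∣N : 2 ∣ N
  2∣N = 2∣2^ k≥1

  entry-first : ∀ j → entry j zero ≡ 1
  entry-first j with ∈-lexProd⁻ (coordVals k I) (∈-lookup j) zero
  ... | here eq = trans (cong toℕ eq) (trans (toℕ-toZ 1) (m<n⇒m%n≡m (^-monoʳ-≤ 2 k≥1)))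

  rowVals : ∀ ρ → ∃[ j ] j ≤ k × lookup (coordVals k I) (suc ρ) ≡ groupVals k j
  rowVals = groupsFrom-lookup 0 I ≤-refl

  columns-unique : Unique (columns k I)
  columns-unique = lexProd-unique (coordVals k I) unique
    where
    unique : ∀ ρ → Unique (lookup (coordVals k I) ρ)
    unique zero = All.[] ∷ AllPairs.[]
    unique (suc ρ) with rowVals ρ
    ... | j , j≤k , eq = subst Unique (sym eq) (groupVals-unique j≤k)

  syndrome-first : ∀ h → syndrome h zero ≡ V.sum (V.map toℕ h)
  syndrome-first h = cong V.sum (begin
    tabulate (λ j → entry j zero * toℕ (lookup h j)) ≡⟨ tabulate-cong (λ j → trans (cong (_* toℕ (lookup h j)) (entry-first j)) (*-identityˡ _)) ⟩
    tabulate (toℕ ∘ lookup h)                           ≡⟨ tabulate-∘ toℕ (lookup h) ⟩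
    V.map toℕ (tabulate (lookup h))                     ≡⟨ cong (V.map toℕ) (tabulate∘lookup h) ⟩
    V.map toℕ h                                         ∎)

  part≡syndrome-first%2 : ∀ h → part k h ≡ syndrome h zero % 2
  part≡syndrome-first%2 h = trans (part≡sum%2 h) (cong (_% 2) (sym (syndrome-first h)))

  codeword-part : ∀ c → HI k I c → part k c ≡ 0
  codeword-part c cI = trans (part≡syndrome-first%2 c) (≋⇒%-divisor {y = 0} 2∣N (Equivalence.to (HI⇔syndrome≋0 c) cI zero))

  syndrome-update : ∀ (c y : Word k n) {j} → AgreeOutside j c y → ∀ ρ →
    syndrome c ρ + entry j ρ * toℕ (subZ k (lookup y j) (lookup c j)) ≋ syndrome y ρ
  syndrome-update c y {j} agree ρ = +-cancelʳ (e * toℕ (lookup c j)) (begin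
    (syndrome c ρ + e * δ + e * toℕ (lookup c j)) % N   ≡⟨ cong (_% N) (+-assoc (syndrome c ρ) _ _) ⟩
    (syndrome c ρ + (e * δ + e * toℕ (lookup c j))) % N ≡⟨ cong (λ m → (syndrome c ρ + m) % N) (*-distribˡ-+ e δ _) ⟨
    (syndrome c ρ + e * (δ + toℕ (lookup c j))) % N     ≡⟨ +-cong {syndrome c ρ} refl (*-congˡ e (subZ-+ (lookup y j) (lookup c j))) ⟩
    (syndrome c ρ + e * toℕ (lookup y j)) % N           ≡⟨ cong (_% N) (sum-tabulate-update _ _ j (λ i i≢j → cong (λ x → entry i ρ * toℕ x) (agree i i≢j))) ⟩
    (syndrome y ρ + e * toℕ (lookup c j)) % N           ∎)
    where
    e δ : ℕ
    e = entry j ρ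
    δ = toℕ (subZ k (lookup y j) (lookup c j))

  -- The columns are all vectors with first entry 1 and ρ-th entry in the
  -- subgroup of row ρ; a syndrome has its entries in these subgroups.
  scaled-syndrome∈columns : ∀ y u → u * syndrome y zero ≋ 1 →
    tabulate (λ ρ → toZ k (u * syndrome y ρ)) ∈ columns k I
  scaled-syndrome∈columns y u us₀≋1 = ∈-lexProd⁺ (coordVals k I) _ λ ρ →
    subst (_∈ lookup (coordVals k I) ρ) (sym (lookup∘tabulate (λ ρ → toZ k (u * syndrome y ρ)) ρ)) (row ρ)
    where
    row : ∀ ρ → toZ k (u * syndrome y ρ) ∈ lookup (coordVals k I) ρ
    row zero = here (Equivalence.from toZ-≋ us₀≋1)
    row (suc ρ) with rowVals ρ
    ... | j , j≤k , eq = subst (_ ∈_) (sym eq) (∈-groupVals⁺ j≤k _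
      (subst (step j ∣_) (sym (toℕ-toZ _)) (∣⇒∣% (step∣N j≤k) (∣n⇒∣m*n u (∣-sum (step j) _ step∣entry)))))
      where
      step∣entry : ∀ i → step j ∣ entry i (suc ρ) * toℕ (lookup y i)
      step∣entry i = ∣m⇒∣m*n (toℕ (lookup y i)) (∈-groupVals⁻ j≤k (subst (lookup (col i) (suc ρ) ∈_) eq (∈-lexProd⁻ (coordVals k I) (∈-lookup i) (suc ρ))))

  module Decoding (y : Word k n) (y-odd : part k y ≢ 0) where

    s : Fin D → ℕ
    s = syndrome y

    A : Zk k
    A = toZ k (s zero)

    a : ℕ
    a = toℕ A

    a-odd : a % 2 ≡ 1
    a-odd = trans (≋⇒%-divisor 2∣N (toℕ-toZ≋ (s zero)))
      (%2≢0⇒%2≡1 (s zero) (y-odd ∘ trans (part≡syndrome-first%2 y)))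

    inverse : ∃[ u ] ∃[ q ] a * u ≡ 1 + q * 2 ^ k
    inverse = odd-invertible k {a} a-odd

    u : ℕ
    u = proj₁ inverse

    au≋1 : a * u ≋ 1
    au≋1 = trans (cong (_% N) (proj₂ (proj₂ inverse))) ([m+kn]%n≡m%n 1 (proj₁ (proj₂ inverse)) N)

    scaled∈ : tabulate (λ ρ → toZ k (u * s ρ)) ∈ columns k I
    scaled∈ = scaled-syndrome∈columns y u (trans (*-congˡ u (sym (toℕ-toZ≋ (s zero)))) (trans (cong (_% N) (*-comm u a)) au≋1))

    j★ : Fin n
    j★ = Any.index scaled∈

    entry-j★*a : ∀ ρ → entry j★ ρ * a ≋ s ρ
    entry-j★*a ρ = begin
      (entry j★ ρ * a) % N      ≡⟨ *-congʳ a entry-j★ ⟩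
      (u * s ρ * a) % N         ≡⟨ cong (_% N) (trans (*-assoc u (s ρ) a) (trans (*-comm u _) (*-assoc (s ρ) a u))) ⟩
      (s ρ * (a * u)) % N       ≡⟨ *-congˡ (s ρ) au≋1 ⟩
      (s ρ * 1) % N             ≡⟨ cong (_% N) (*-identityʳ (s ρ)) ⟩
      s ρ % N                   ∎
      where
      entry-j★ : entry j★ ρ ≋ u * s ρ
      entry-j★ = subst (λ v → toℕ (lookup v ρ) ≋ u * s ρ) (lookup-index scaled∈)
        (subst (λ x → toℕ x ≋ u * s ρ) (sym (lookup∘tabulate (λ ρ → toZ k (u * s ρ)) ρ)) (toℕ-toZ≋ (u * s ρ)))

    c★ : Word k n
    c★ = y [ j★ ]≔ subZ k (lookup y j★) A

    c★-agrees : AgreeOutside j★ c★ y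
    c★-agrees = AgreeOutside-update j★ y _

    c★-error : subZ k (lookup y j★) (lookup c★ j★) ≡ A
    c★-error = trans (cong (subZ k (lookup y j★)) (lookup∘update j★ y _)) (subZ-involutive (lookup y j★) A)

    c★∈HI : HI k I c★
    c★∈HI = Equivalence.from (HI⇔syndrome≋0 c★) λ ρ → +-cancelʳ (entry j★ ρ * a)
      (trans (subst (λ x → syndrome c★ ρ + entry j★ ρ * toℕ x ≋ s ρ) c★-error (syndrome-update c★ y c★-agrees ρ))
             (sym (entry-j★*a ρ)))

    d◇c★≡1 : d◇ k c★ y ≡ 1
    d◇c★≡1 = trans (AgreeOutside⇒d◇ c★ y c★-agrees) (trans (cong (wt◇ k) c★-error) (odd⇒wtℕ≡1 a a-odd))

    module _ {c : Word k n} {j : Fin n} (cI : HI k I c) (agree : AgreeOutside j c y) where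

      error : Zk k
      error = subZ k (lookup y j) (lookup c j)

      error·entry≋s : ∀ ρ → entry j ρ * toℕ error ≋ s ρ
      error·entry≋s ρ = trans (+-cong {0} (sym (Equivalence.to (HI⇔syndrome≋0 c) cI ρ)) refl) (syndrome-update c y agree ρ)

      error≡A : error ≡ A
      error≡A = ≋⇒≡ (begin
        toℕ error % N                   ≡⟨ cong (_% N) (*-identityˡ (toℕ error)) ⟨
        (1 * toℕ error) % N             ≡⟨ cong (λ m → (m * toℕ error) % N) (entry-first j) ⟨
        (entry j zero * toℕ error) % N  ≡⟨ error·entry≋s zero ⟩
        s zero % N                      ≡⟨ toℕ-toZ≋ (s zero) ⟨
        a % N                           ∎)

      j≡j★ : j ≡ j★
      j≡j★ = Unique-lookup-injective columns-unique j j★ (Pointwise-≡⇒≡ (ext λ ρ → ≋⇒≡ (*-cancelʳ {a} {u} au≋1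
        (trans (subst (λ x → entry j ρ * toℕ x ≋ s ρ) error≡A (error·entry≋s ρ)) (sym (entry-j★*a ρ))))))

      c≡c★ : c ≡ c★
      c≡c★ = begin
        c                                     ≡⟨ AgreeOutside⇒update c y agree ⟩
        y [ j ]≔ lookup c j                   ≡⟨ cong (y [ j ]≔_) c-j ⟩
        y [ j ]≔ subZ k (lookup y j) A        ≡⟨ cong (λ i → y [ i ]≔ subZ k (lookup y i) A) j≡j★ ⟩
        c★                                    ∎
        where
        c-j : lookup c j ≡ subZ k (lookup y j) A
        c-j = trans (sym (subZ-involutive (lookup y j) (lookup c j))) (cong (subZ k (lookup y j)) error≡A)

    c★-unique : ∀ c → HI k I c → d◇ k c y ≡ 1 → c ≡ c★
    c★-unique c cI d≡1 = c≡c★ cI (proj₂ (d◇≡1⇒AgreeOutside c y d≡1))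

  HI-1′-perfect : Is1'Perfect k n (HI k I)
  HI-1′-perfect = 0 , codeword-part , λ y y-odd → let open Decoding y y-odd in
    c★ , (c★∈HI , d◇c★≡1) , c★-unique

lemma4 : (k r : ℕ) → k ≥ 1 → (I : Vec ℕ k) → weightedSum I ≡ r →
    (len k I ≡ 2 ^ r) × Is1'Perfect k (len k I) (HI k I)
lemma4 k r k≥1 I weightedSum≡r =
  subst (λ m → len k I ≡ 2 ^ m) weightedSum≡r (len≡2^weightedSum k I) , ParityCheck.HI-1′-perfect k k≥1 I
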